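{- Let $x,y\in M$. (i) If $x,y\in M_1$, then $x\cup y\in M_1$. (ii) If $x,y\in M\setminus M_1$, then $x\cup y\in M\setminus M_1$. (iii) If $x\in M_1$ and $y\in M\setminus M_1$, then $x\cup y\notin M$.
   Context: Work in ZFA, i.e. ZF with a set $A$ of atoms. Fix a preorder $\preccurlyeq$ on $A$ with no minimal elements: for every $a\in A$ there is $b\in A$ with $b\preccurlyeq a$ and $a\not\preccurlyeq b$. Define the magmatic hierarchy: $M_1$ is the set of nonempty subsets $x\subseteq A$ that are downward closed ($a\in x$ and $b\preccurlyeq a$ imply $b\in x$); for $\alpha\geq 1$, $M_{\alpha+1}$ is the set of nonempty $x\subseteq M_\alpha$ such that for every $y\in x$, every $z\in M_\alpha$ with $z\subseteq y$ belongs to $x$; $M_\lambda=\bigcup_{1\leq\beta<\lambda}M_\beta$ for limit $\lambda$; $M=\bigcup_{\alpha\geq1}M_\alpha$. -}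

module Defs where

-- A model of ZFA (sets with atoms) inside Agda, in the style of Aczel's
-- type-theoretic interpretation of set theory, extended by atoms.

open import Data.Product using (Σ; ∃; _×_; _,_)
open import Data.Sum using (_⊎_; inj₁; inj₂; [_,_])
open import Data.Empty using (⊥)
open import Data.Unit using (⊤)
open import Relation.Nullary using (¬_)
open import Relation.Binary.PropositionalEquality using (_≡_)
open import Level using (Lift)

data V (A : Set) : Set₁ where
  atom : A → V A
  sup  : (I : Set) → (I → V A) → V A     -- the set { f i | i ∈ I }

module _ {A : Set} where

  _≐_ : V A → V A → Set
  atom a  ≐ atom b  = a ≡ b
  atom _  ≐ sup _ _ = ⊥
  sup _ _ ≐ atom _  = ⊥
  sup I f ≐ sup J g =
    ((i : I) → Σ J λ j → f i ≐ g j) × ((j : J) → Σ I λ i → f i ≐ g j)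

  _∈_ : V A → V A → Set
  x ∈ atom _  = ⊥
  x ∈ sup I f = Σ I λ i → x ≐ f i

  _∉_ : V A → V A → Set
  x ∉ y = ¬ (x ∈ y)

  _⊆_ : V A → V A → Set₁
  x ⊆ y = (z : V A) → z ∈ x → z ∈ y

  IsSet : V A → Set
  IsSet (atom _)  = ⊥
  IsSet (sup _ _) = ⊤

  IsAtom : V A → Set
  IsAtom z = Σ A λ a → z ≐ atom a

  NonEmpty : V A → Set₁
  NonEmpty x = Σ (V A) λ z → z ∈ x

  index : V A → Set
  index (atom _)  = ⊥
  index (sup I _) = I

  elem : (x : V A) → index x → V A
  elem (atom _)  ()
  elem (sup _ f) i = f i

  _∪_ : V A → V A → V A
  x ∪ y = sup (index x ⊎ index y) [ elem x , elem y ]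

-- Ordinals (≥ 1) as well-founded trees: one = 1, succ α = α + 1,
-- lim I f = sup of the family f (required to be a limit, see IsOrd).

data Ord : Set₁ where
  one  : Ord
  succ : Ord → Ord
  lim  : (I : Set) → (I → Ord) → Ord

mutual
  _<ₒ_ : Ord → Ord → Set
  β <ₒ one      = ⊥
  β <ₒ succ α   = β ≤ₒ α
  β <ₒ lim I f  = Σ I λ i → β <ₒ f i

  _≤ₒ_ : Ord → Ord → Set
  one      ≤ₒ α = ⊤
  succ β   ≤ₒ α = β <ₒ α
  lim I f  ≤ₒ α = (i : I) → f i ≤ₒ α

-- well-formed ordinal notations: limit nodes are genuine limits
-- (nonempty family without a largest element)
IsOrd : Ord → Set
IsOrd one        = ⊤
IsOrd (succ α)   = IsOrd α
IsOrd (lim I f)  =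
  ((i : I) → IsOrd (f i)) × I × ((i : I) → Σ I λ j → f i <ₒ f j)

module Magmatic {A : Set} (_≼_ : A → A → Set) where

  M₁ : V A → Set₁
  M₁ x = IsSet x × NonEmpty x × ((z : V A) → z ∈ x → IsAtom z)
         × ((a b : A) → atom a ∈ x → b ≼ a → atom b ∈ x)

  Next : (V A → Set₁) → V A → Set₁
  Next Mα x = IsSet x × NonEmpty x × ((z : V A) → z ∈ x → Mα z)
              × ((y : V A) → y ∈ x → (z : V A) → Mα z → z ⊆ y → z ∈ x)

  mutual
    Mat : Ord → V A → Set₁
    Mat one       x = M₁ x
    Mat (succ α)  x = Next (Mat α) x
    Mat (lim I f) x = Below (lim I f) x

    -- Below α x  :  x ∈ ⋃_{1 ≤ β < α} M_β
    Below : Ord → V A → Set₁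
    Below one       x = Lift (Level.suc Level.zero) ⊥
    Below (succ α)  x = Below α x ⊎ Mat α x
    Below (lim I f) x = Σ I λ i → Below (f i) x

  InM : V A → Set₁
  InM x = Σ Ord λ α → IsOrd α × Mat α x

{-# OPTIONS --safe #-}
module Submission where

-- Every member of M is either in M₁ (all its elements are atoms) or in a
-- successor level M_{δ+1} (all its elements are sets), so a union mixing
-- the two kinds is in neither.  Two successor-level sets x ∈ M_{a+1} and
-- y ∈ M_{b+1} have their union in M_{λ+1} for a limit λ above a and b:
-- the closure condition at level λ reduces to that of x and y because each
-- M_α is closed under passing to subsets that lie in M.

open import Defs
open import Data.Bool using (true; false; if_then_else_)
open import Data.Nat using (ℕ; zero; suc)
open import Data.Product using (Σ; _×_; _,_)
open import Data.Sum using (_⊎_; inj₁; inj₂; [_,_]′)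
open import Data.Empty using (⊥-elim)
open import Data.Unit using (tt)
open import Relation.Nullary using (¬_)
open import Relation.Binary.PropositionalEquality using (_≡_; sym; trans)
open import Relation.Binary.Structures using (IsPreorder)

module _ {A : Set} where

  ≐-sym : (x y : V A) → x ≐ y → y ≐ x
  ≐-sym (atom _)  (atom _)  p = sym p
  ≐-sym (sup _ f) (sup _ g) (p , q) =
    (λ j → let (i , e) = q j in i , ≐-sym (f i) (g j) e) ,
    (λ i → let (j , e) = p i in j , ≐-sym (f i) (g j) e)

  ≐-trans : (x y z : V A) → x ≐ y → y ≐ z → x ≐ z
  ≐-trans (atom _)  (atom _)  (atom _)  p q = trans p q
  ≐-trans (sup _ f) (sup _ g) (sup _ h) (p , p′) (q , q′) =
    (λ i → let (j , e) = p i ; (k , e′) = q j in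
             k , ≐-trans (f i) (g j) (h k) e e′) ,
    (λ k → let (j , e′) = q′ k ; (i , e) = p′ j in
             i , ≐-trans (f i) (g j) (h k) e e′)

  ∈-respʳ : (x y y′ : V A) → y ≐ y′ → x ∈ y → x ∈ y′
  ∈-respʳ x (sup _ f) (sup _ g) (p , _) (i , e) =
    let (j , e′) = p i in j , ≐-trans x (f i) (g j) e e′

  ⊆-respʳ : (x y y′ : V A) → y ≐ y′ → x ⊆ y → x ⊆ y′
  ⊆-respʳ x y y′ e x⊆y z z∈x = ∈-respʳ z y y′ e (x⊆y z z∈x)

  IsSet-resp : (x x′ : V A) → x ≐ x′ → IsSet x → IsSet x′
  IsSet-resp (sup _ _) (sup _ _) _ _ = tt

  IsSet⇒¬IsAtom : (x : V A) → IsSet x → ¬ IsAtom x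
  IsSet⇒¬IsAtom (sup _ _) _ (_ , ())

  ∈-∪⁺ˡ : (x y z : V A) → z ∈ x → z ∈ (x ∪ y)
  ∈-∪⁺ˡ (sup _ _) y z (i , e) = inj₁ i , e

  ∈-∪⁺ʳ : (x y z : V A) → z ∈ y → z ∈ (x ∪ y)
  ∈-∪⁺ʳ x (sup _ _) z (j , e) = inj₂ j , e

  ∈-∪⁻ : (x y z : V A) → z ∈ (x ∪ y) → z ∈ x ⊎ z ∈ y
  ∈-∪⁻ (sup _ _) y z (inj₁ i , e) = inj₁ (i , e)
  ∈-∪⁻ x (sup _ _) z (inj₂ j , e) = inj₂ (j , e)

≤ₒ-lim : (I : Set) (f : I → Ord) (i : I) (β : Ord) → β ≤ₒ f i → β ≤ₒ lim I f
≤ₒ-lim I f i one       _   = tt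
≤ₒ-lim I f i (succ β)  β<fi = i , β<fi
≤ₒ-lim I f i (lim J g) g≤fi = λ j → ≤ₒ-lim I f i (g j) (g≤fi j)

≤ₒ-refl : (α : Ord) → α ≤ₒ α
≤ₒ-refl one       = tt
≤ₒ-refl (succ α)  = ≤ₒ-refl α
≤ₒ-refl (lim I f) = λ i → ≤ₒ-lim I f i (f i) (≤ₒ-refl (f i))

_+ₒ_ : Ord → ℕ → Ord
α +ₒ zero  = α
α +ₒ suc n = succ (α +ₒ n)

IsOrd-+ₒ : (α : Ord) → IsOrd α → (n : ℕ) → IsOrd (α +ₒ n)
IsOrd-+ₒ α oα zero    = oα
IsOrd-+ₒ α oα (suc n) = IsOrd-+ₒ α oα n

ω-above : {I : Set} → (I → Ord) → Ord
ω-above {I} f = lim (I × ℕ) λ (i , n) → f i +ₒ suc n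

IsOrd-ω-above : {I : Set} (f : I → Ord) → I → ((i : I) → IsOrd (f i))
                → IsOrd (ω-above f)
IsOrd-ω-above f i₀ of =
  (λ (i , n) → IsOrd-+ₒ (f i) (of i) (suc n)) ,
  (i₀ , zero) ,
  (λ (i , n) → (i , suc n) , ≤ₒ-refl (f i +ₒ suc n))

module MagmaticProperties {A : Set} (_≼_ : A → A → Set) where
  open Magmatic _≼_

  InSucc : V A → Set₁
  InSucc x = Σ Ord λ δ → IsOrd δ × Next (Mat δ) x

  M₁⇒InM : (x : V A) → M₁ x → InM x
  M₁⇒InM x m = one , tt , m

  InSucc⇒InM : (x : V A) → InSucc x → InM x
  InSucc⇒InM x (δ , oδ , m) = succ δ , oδ , m

  M₁-resp : (x x′ : V A) → x ≐ x′ → M₁ x → M₁ x′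
  M₁-resp x x′ e (s , (w , w∈x) , atoms , down) =
    IsSet-resp x x′ e s ,
    (w , ∈-respʳ w x x′ e w∈x) ,
    (λ z z∈x′ → atoms z (∈-respʳ z x′ x e′ z∈x′)) ,
    (λ a b a∈x′ b≼a → ∈-respʳ (atom b) x x′ e (down a b (∈-respʳ (atom a) x′ x e′ a∈x′) b≼a))
    where e′ = ≐-sym x x′ e

  Next-resp : (P : V A → Set₁) (x x′ : V A) → x ≐ x′ → Next P x → Next P x′
  Next-resp P x x′ e (s , (w , w∈x) , elems , closed) =
    IsSet-resp x x′ e s ,
    (w , ∈-respʳ w x x′ e w∈x) ,
    (λ z z∈x′ → elems z (∈-respʳ z x′ x e′ z∈x′)) ,
    (λ y y∈x′ z Pz z⊆y → ∈-respʳ z x x′ e (closed y (∈-respʳ y x′ x e′ y∈x′) z Pz z⊆y))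
    where e′ = ≐-sym x x′ e

  mutual
    Mat-resp : (α : Ord) (x x′ : V A) → x ≐ x′ → Mat α x → Mat α x′
    Mat-resp one       x x′ e m = M₁-resp x x′ e m
    Mat-resp (succ α)  x x′ e m = Next-resp (Mat α) x x′ e m
    Mat-resp (lim I f) x x′ e m = Below-resp (lim I f) x x′ e m

    Below-resp : (α : Ord) (x x′ : V A) → x ≐ x′ → Below α x → Below α x′
    Below-resp (succ α)  x x′ e (inj₁ b) = inj₁ (Below-resp α x x′ e b)
    Below-resp (succ α)  x x′ e (inj₂ m) = inj₂ (Mat-resp α x x′ e m)
    Below-resp (lim I f) x x′ e (i , b)  = i , Below-resp (f i) x x′ e b

  mutual
    Mat-cases : (α : Ord) → IsOrd α → (x : V A) → Mat α x → M₁ x ⊎ InSucc x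
    Mat-cases one       _  x m = inj₁ m
    Mat-cases (succ α)  oα x m = inj₂ (α , oα , m)
    Mat-cases (lim I f) oα x b = Below-cases (lim I f) oα x b

    Below-cases : (α : Ord) → IsOrd α → (x : V A) → Below α x → M₁ x ⊎ InSucc x
    Below-cases (succ α)  oα       x (inj₁ b) = Below-cases α oα x b
    Below-cases (succ α)  oα       x (inj₂ m) = Mat-cases α oα x m
    Below-cases (lim I f) (of , _) x (i , b)  = Below-cases (f i) (of i) x b

  InM-cases : (x : V A) → InM x → M₁ x ⊎ InSucc x
  InM-cases x (α , oα , m) = Mat-cases α oα x m

  Below⇒InM : (α : Ord) → IsOrd α → (x : V A) → Below α x → InM x
  Below⇒InM α oα x b = [ M₁⇒InM x , InSucc⇒InM x ]′ (Below-cases α oα x b)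

  InM⇒IsSet : (x : V A) → InM x → IsSet x
  InM⇒IsSet x m with InM-cases x m
  ... | inj₁ (s , _) = s
  ... | inj₂ (_ , _ , s , _) = s

  M₁-InSucc-disjoint : (x y z : V A) → M₁ x → InSucc y → z ∈ x → z ∉ y
  M₁-InSucc-disjoint x y z (_ , _ , atoms , _) (δ , oδ , _ , _ , elems , _) z∈x z∈y =
    IsSet⇒¬IsAtom z (InM⇒IsSet z (δ , oδ , elems z z∈y)) (atoms z z∈x)

  ¬M₁⇒InSucc : (x : V A) → InM x → ¬ M₁ x → InSucc x
  ¬M₁⇒InSucc x ix ¬mx = [ (λ mx → ⊥-elim (¬mx mx)) , (λ sx → sx) ]′ (InM-cases x ix)

  InSucc⇒¬M₁ : (x : V A) → InSucc x → ¬ M₁ x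
  InSucc⇒¬M₁ x sx@(_ , _ , _ , (z , z∈x) , _) mx = M₁-InSucc-disjoint x x z mx sx z∈x z∈x

  -- By induction on w, not on α: in the successor case the recursive call is
  -- at the level δ of z, on the element of w that an element of z equals.
  mutual
    Mat-downward-closed : (α : Ord) → IsOrd α → (w z : V A)
                          → Mat α w → InM z → z ⊆ w → Mat α z
    Mat-downward-closed one _ w z mw iz z⊆w with InM-cases z iz
    ... | inj₁ mz = mz
    ... | inj₂ sz@(_ , _ , _ , (e , e∈z) , _) =
      ⊥-elim (M₁-InSucc-disjoint w z e mw sz (z⊆w e e∈z) e∈z)
    Mat-downward-closed (succ β) oβ w@(sup _ f) z mw@(_ , _ , elems , _) iz z⊆w
      with InM-cases z iz
    ... | inj₁ mz@(_ , (e , e∈z) , _) =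
      ⊥-elim (M₁-InSucc-disjoint z w e mz (β , oβ , mw) e∈z (z⊆w e e∈z))
    ... | inj₂ (δ , oδ , sz , nz , elemsz , closedz) =
      sz , nz , (λ e e∈z → elems e (z⊆w e e∈z)) , closed
      where
        closed : (u : V A) → u ∈ z → (v : V A) → Mat β v → v ⊆ u → v ∈ z
        closed u u∈z v mv v⊆u =
          let (i , u≐fi) = z⊆w u u∈z
              mδv = Mat-downward-closed δ oδ (f i) v
                      (Mat-resp δ u (f i) u≐fi (elemsz u u∈z))
                      (β , oβ , mv)
                      (⊆-respʳ v u (f i) u≐fi v⊆u)
          in closedz u u∈z v mδv v⊆u
    Mat-downward-closed (lim I f) oα w z mw iz z⊆w =
      Below-downward-closed (lim I f) oα w z mw iz z⊆w

    Below-downward-closed : (α : Ord) → IsOrd α → (w z : V A)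
                            → Below α w → InM z → z ⊆ w → Below α z
    Below-downward-closed (succ α) oα w z (inj₁ b) iz z⊆w =
      inj₁ (Below-downward-closed α oα w z b iz z⊆w)
    Below-downward-closed (succ α) oα w z (inj₂ m) iz z⊆w =
      inj₂ (Mat-downward-closed α oα w z m iz z⊆w)
    Below-downward-closed (lim I f) (of , _) w z (i , b) iz z⊆w =
      i , Below-downward-closed (f i) (of i) w z b iz z⊆w

  InSucc-closed : (x w z : V A) → InSucc x → w ∈ x → InM z → z ⊆ w → z ∈ x
  InSucc-closed x w z (δ , oδ , _ , _ , elems , closed) w∈x iz z⊆w =
    closed w w∈x z (Mat-downward-closed δ oδ w z (elems w w∈x) iz z⊆w) z⊆w

  M₁-∪ : (x y : V A) → M₁ x → M₁ y → M₁ (x ∪ y)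
  M₁-∪ x y (_ , (w , w∈x) , atomsx , downx) (_ , _ , atomsy , downy) =
    tt , (w , ∈-∪⁺ˡ x y w w∈x) , atoms , down
    where
      atoms : (z : V A) → z ∈ (x ∪ y) → IsAtom z
      atoms z z∈ = [ atomsx z , atomsy z ]′ (∈-∪⁻ x y z z∈)
      down : (a b : A) → atom a ∈ (x ∪ y) → b ≼ a → atom b ∈ (x ∪ y)
      down a b a∈ b≼a =
        [ (λ a∈x → ∈-∪⁺ˡ x y (atom b) (downx a b a∈x b≼a)) ,
          (λ a∈y → ∈-∪⁺ʳ x y (atom b) (downy a b a∈y b≼a)) ]′ (∈-∪⁻ x y (atom a) a∈)

  InSucc-∪ : (x y : V A) → InSucc x → InSucc y → InSucc (x ∪ y)
  InSucc-∪ x y sx@(a , oa , _ , (w , w∈x) , elemsx , _) sy@(b , ob , _ , _ , elemsy , _) =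
    λ̂ , oλ̂ , tt , (w , ∈-∪⁺ˡ x y w w∈x) , elems , closed
    where
      λ̂ = ω-above (λ c → if c then a else b)
      oλ̂ : IsOrd λ̂
      oλ̂ = IsOrd-ω-above _ true λ { true → oa ; false → ob }
      elems : (z : V A) → z ∈ (x ∪ y) → Below λ̂ z
      elems z z∈ = [ (λ z∈x → (true , zero) , inj₂ (elemsx z z∈x)) ,
                     (λ z∈y → (false , zero) , inj₂ (elemsy z z∈y)) ]′ (∈-∪⁻ x y z z∈)
      closed : (u : V A) → u ∈ (x ∪ y) → (z : V A) → Below λ̂ z → z ⊆ u → z ∈ (x ∪ y)
      closed u u∈ z bz z⊆u =
        [ (λ u∈x → ∈-∪⁺ˡ x y z (InSucc-closed x u z sx u∈x iz z⊆u)) ,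
          (λ u∈y → ∈-∪⁺ʳ x y z (InSucc-closed y u z sy u∈y iz z⊆u)) ]′ (∈-∪⁻ x y u u∈)
        where iz = Below⇒InM λ̂ oλ̂ z bz

  M₁-∪-InSucc-∉M : (x y : V A) → M₁ x → InSucc y → ¬ InM (x ∪ y)
  M₁-∪-InSucc-∉M x y mx@(_ , (d , d∈x) , _) sy@(_ , _ , _ , (e , e∈y) , _) ixy
    with InM-cases (x ∪ y) ixy
  ... | inj₁ mxy = M₁-InSucc-disjoint (x ∪ y) y e mxy sy (∈-∪⁺ʳ x y e e∈y) e∈y
  ... | inj₂ sxy = M₁-InSucc-disjoint x (x ∪ y) d mx sxy d∈x (∈-∪⁺ˡ x y d d∈x)

lemma2p4 : (A : Set) (_≼_ : A → A → Set)
           → IsPreorder _≡_ _≼_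
           → ((a : A) → Σ A λ b → b ≼ a × ¬ (a ≼ b))
           → (x y : V A)
           → Magmatic.InM _≼_ x → Magmatic.InM _≼_ y
           → ((Magmatic.M₁ _≼_ x → Magmatic.M₁ _≼_ y → Magmatic.M₁ _≼_ (x ∪ y))
             × (¬ Magmatic.M₁ _≼_ x → ¬ Magmatic.M₁ _≼_ y
                → Magmatic.InM _≼_ (x ∪ y) × ¬ Magmatic.M₁ _≼_ (x ∪ y))
             × (Magmatic.M₁ _≼_ x → ¬ Magmatic.M₁ _≼_ y → ¬ Magmatic.InM _≼_ (x ∪ y)))
lemma2p4 A _≼_ _ _ x y ix iy =
  M₁-∪ x y ,
  (λ ¬mx ¬my → let sxy = InSucc-∪ x y (¬M₁⇒InSucc x ix ¬mx) (¬M₁⇒InSucc y iy ¬my) in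
                 InSucc⇒InM (x ∪ y) sxy , InSucc⇒¬M₁ (x ∪ y) sxy) ,
  (λ mx ¬my → M₁-∪-InSucc-∉M x y mx (¬M₁⇒InSucc y iy ¬my))
  where open MagmaticProperties _≼_
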